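{- Let $q\in\mathbb{C}$ with $|q|<1$, let $n\ge1$ and $m\ge0$ be integers. Then for $x\in[0,1]$, $$[n]_q^m\,\mathbb{B}_{n,q}(t^m\mid x)=\sum_{k=0}^n\binom{n}{k}_q x^k\,\Delta_q^k0^m,\qquad\text{where }\Delta_q^k0^m=\sum_{j=0}^k\binom{k}{j}_q(-1)^{k-j}q^{\binom{k-j}{2}}[j]_q^m.$$
   Context: $[x]_q=\frac{1-q^x}{1-q}$, $[n]_q!=[n]_q\cdots[1]_q$, $[0]_q!=1$, $\binom{n}{k}_q=\frac{[n]_q!}{[k]_q![n-k]_q!}$, with the convention $[0]_q^0=1$. $(1-x)_q^m=\prod_{i=1}^m(1-xq^{i-1})$. For $f\in C[0,1]$, $\mathbb{B}_{n,q}(f\mid x)=\sum_{k=0}^n f\!\left(\frac{[k]_q}{[n]_q}\right)\binom{n}{k}_q x^k(1-x)_q^{n-k}$; here $f(t)=t^m$. -}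

module Defs where

open import Level using (Level)
open import Algebra.Bundles using (CommutativeRing)
open import Data.Nat as ℕ using (ℕ; zero; suc; _∸_)
open import Data.Nat.Combinatorics using (_C_)

module _ {c ℓ : Level} (R : CommutativeRing c ℓ) where
  open CommutativeRing R

  -- ring power x^n with x^0 = 1 (so [0]_q^0 = 1)
  pow : Carrier → ℕ → Carrier
  pow x zero    = 1#
  pow x (suc n) = x * pow x n

  sumTo : ℕ → (ℕ → Carrier) → Carrier
  sumTo zero    f = f 0
  sumTo (suc n) f = sumTo n f + f (suc n)

  prod1 : ℕ → (ℕ → Carrier) → Carrier
  prod1 zero    f = 1#
  prod1 (suc n) f = prod1 n f * f (suc n)

  -- q-integer [x]_q = (1 - q^x)/(1 - q) = 1 + q + ... + q^(x-1)
  qint : Carrier → ℕ → Carrier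
  qint q zero    = 0#
  qint q (suc x) = 1# + q * qint q x

  qfact : Carrier → ℕ → Carrier
  qfact q n = prod1 n (qint q)

  -- inverse of [n]_q!, built from given inverses inv j of [j]_q
  qfactInv : (ℕ → Carrier) → ℕ → Carrier
  qfactInv inv n = prod1 n inv

  -- q-binomial [n]_q! / ([k]_q! [n-k]_q!)  (used only for k ≤ n)
  qbinom : Carrier → (ℕ → Carrier) → ℕ → ℕ → Carrier
  qbinom q inv n k = qfact q n * (qfactInv inv k * qfactInv inv (n ∸ k))

  qpochMinus : Carrier → Carrier → ℕ → Carrier
  qpochMinus q x m = prod1 m (λ i → 1# - x * pow q (i ∸ 1))

  -- q-Bernstein operator applied to f(t) = t^m:
  -- B_{n,q}(t^m | x) = Σ_{k=0}^n ([k]_q/[n]_q)^m [n k]_q x^k (1-x)_q^{n-k}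
  qBernsteinPow : Carrier → (ℕ → Carrier) → ℕ → ℕ → Carrier → Carrier
  qBernsteinPow q inv n m x =
    sumTo n (λ k → pow (qint q k * inv n) m
                   * (qbinom q inv n k * (pow x k * qpochMinus q x (n ∸ k))))

  qDelta0 : Carrier → (ℕ → Carrier) → ℕ → ℕ → Carrier
  qDelta0 q inv k m =
    sumTo k (λ j → qbinom q inv k j
                   * (pow (- 1#) (k ∸ j) * (pow q ((k ∸ j) C 2) * pow (qint q j) m)))

{-# OPTIONS --safe #-}
-- Cancelling [n]_q^m against [n]_q^{-m}, the k-th Bernstein summand becomes
-- [k]_q^m [n k]_q x^k (1-x)_q^{n-k}.  Cauchy's q-binomial theorem expands
-- (1-x)_q^{n-k} = Σ_i [n-k i]_q (-1)^i q^(i choose 2) x^i, the subset identity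
-- [n k]_q [n-k i]_q = [n k+i]_q [k+i k]_q makes [n l]_q x^l a common factor of all
-- terms with k + i = l, and what remains is Δ_q^l 0^m.  The binomial theorem is
-- proved for the inverse-free q-Pascal coefficients, which agree with the
-- factorial formula wherever the inverses of [1]_q, …, [n]_q are available.
module Submission where

open import Defs
open import Level using (Level)
open import Algebra.Bundles using (CommutativeRing)
open import Data.Nat as ℕ using (ℕ; zero; suc; _∸_; s≤s; z≤n)
import Data.Nat.Properties as ℕₚ
open import Data.Nat.Combinatorics using (_C_; nC1≡n; nCk+nC[k+1]≡[n+1]C[k+1])
open import Relation.Binary.PropositionalEquality as ≡ using (_≡_)

suc[n]C2≡n+nC2 : ∀ n → suc n C 2 ≡ n ℕ.+ n C 2
suc[n]C2≡n+nC2 n =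
  ≡.trans (≡.sym (nCk+nC[k+1]≡[n+1]C[k+1] n 1)) (≡.cong (ℕ._+ n C 2) (nC1≡n n))

module RingFacts {c ℓ : Level} (R : CommutativeRing c ℓ) where
  open CommutativeRing R
  open import Relation.Binary.Reasoning.Setoid setoid
  open import Algebra.Solver.Ring.NaturalCoefficients.Default commutativeSemiring
    using (solve; _:=_; _:+_)
  open import Algebra.Properties.CommutativeSemiring.Exp commutativeSemiring
    using (_^_; ^-homo-*; ^-distrib-*; ^-congˡ)

  pow≡^ : ∀ x n → pow R x n ≡ x ^ n
  pow≡^ x zero    = ≡.refl
  pow≡^ x (suc n) = ≡.cong (x *_) (pow≡^ x n)

  pow-homo-+ : ∀ x m n → pow R x (m ℕ.+ n) ≈ pow R x m * pow R x n
  pow-homo-+ x m n rewrite pow≡^ x (m ℕ.+ n) | pow≡^ x m | pow≡^ x n = ^-homo-* x m n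

  pow-distrib-* : ∀ x y n → pow R (x * y) n ≈ pow R x n * pow R y n
  pow-distrib-* x y n rewrite pow≡^ (x * y) n | pow≡^ x n | pow≡^ y n = ^-distrib-* x y n

  pow-congˡ : ∀ {x y} n → x ≈ y → pow R x n ≈ pow R y n
  pow-congˡ {x} {y} n x≈y rewrite pow≡^ x n | pow≡^ y n = ^-congˡ n x≈y

  pow-1# : ∀ n → pow R 1# n ≈ 1#
  pow-1# zero    = refl
  pow-1# (suc n) = trans (*-identityˡ _) (pow-1# n)

  sumTo-cong : ∀ n {f g : ℕ → Carrier} → (∀ k → k ℕ.≤ n → f k ≈ g k) →
               sumTo R n f ≈ sumTo R n g
  sumTo-cong zero    f≈g = f≈g 0 z≤n
  sumTo-cong (suc n) f≈g =
    +-cong (sumTo-cong n (λ k k≤n → f≈g k (ℕₚ.m≤n⇒m≤1+n k≤n))) (f≈g (suc n) ℕₚ.≤-refl)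

  sumTo-distrib-+ : ∀ n (f g : ℕ → Carrier) →
                    sumTo R n (λ k → f k + g k) ≈ sumTo R n f + sumTo R n g
  sumTo-distrib-+ zero    f g = refl
  sumTo-distrib-+ (suc n) f g = begin
    sumTo R n (λ k → f k + g k) + (f (suc n) + g (suc n))
      ≈⟨ +-congʳ (sumTo-distrib-+ n f g) ⟩
    (sumTo R n f + sumTo R n g) + (f (suc n) + g (suc n))
      ≈⟨ solve 4 (λ a b c d → (a :+ b) :+ (c :+ d) := (a :+ c) :+ (b :+ d)) refl _ _ _ _ ⟩
    (sumTo R n f + f (suc n)) + (sumTo R n g + g (suc n)) ∎

  sumTo-distribˡ : ∀ n a (f : ℕ → Carrier) → a * sumTo R n f ≈ sumTo R n (λ k → a * f k)
  sumTo-distribˡ zero    a f = refl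
  sumTo-distribˡ (suc n) a f = trans (distribˡ a _ _) (+-congʳ (sumTo-distribˡ n a f))

  sumTo-head : ∀ n (f : ℕ → Carrier) → sumTo R (suc n) f ≈ f 0 + sumTo R n (λ k → f (suc k))
  sumTo-head zero    f = refl
  sumTo-head (suc n) f = trans (+-congʳ (sumTo-head n f)) (+-assoc _ _ _)

  sumTo-shift : ∀ n (f : ℕ → Carrier) → f (suc n) ≈ 0# →
                f 0 + sumTo R n (λ k → f (suc k)) ≈ sumTo R n f
  sumTo-shift n f f[1+n]≈0 = begin
    f 0 + sumTo R n (λ k → f (suc k)) ≈⟨ sumTo-head n f ⟨
    sumTo R n f + f (suc n)           ≈⟨ +-congˡ f[1+n]≈0 ⟩
    sumTo R n f + 0#                  ≈⟨ +-identityʳ _ ⟩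
    sumTo R n f                       ∎

  sumTo-antidiagonal : ∀ n (f : ℕ → ℕ → Carrier) →
    sumTo R n (λ k → sumTo R (n ∸ k) (f k)) ≈ sumTo R n (λ l → sumTo R l (λ k → f k (l ∸ k)))
  sumTo-antidiagonal zero    f = refl
  sumTo-antidiagonal (suc n) f = begin
    sumTo R n (λ k → sumTo R (suc n ∸ k) (f k)) + sumTo R (n ∸ n) (f (suc n))
      ≈⟨ +-congˡ (reflexive (≡.cong (λ t → sumTo R t (f (suc n))) (ℕₚ.n∸n≡0 n))) ⟩
    sumTo R n (λ k → sumTo R (suc n ∸ k) (f k)) + f (suc n) 0
      ≈⟨ +-congʳ (sumTo-cong n peel) ⟩
    sumTo R n (λ k → sumTo R (n ∸ k) (f k) + f k (suc n ∸ k)) + f (suc n) 0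
      ≈⟨ +-congʳ (sumTo-distrib-+ n _ _) ⟩
    (sumTo R n (λ k → sumTo R (n ∸ k) (f k)) + sumTo R n (λ k → f k (suc n ∸ k))) + f (suc n) 0
      ≈⟨ +-assoc _ _ _ ⟩
    sumTo R n (λ k → sumTo R (n ∸ k) (f k)) + (sumTo R n (λ k → f k (suc n ∸ k)) + f (suc n) 0)
      ≈⟨ +-congʳ (sumTo-antidiagonal n f) ⟩
    sumTo R n (λ l → sumTo R l (λ k → f k (l ∸ k))) + (sumTo R n (λ k → f k (suc n ∸ k)) + f (suc n) 0)
      ≈⟨ +-congˡ (+-congˡ (reflexive (≡.cong (f (suc n)) (≡.sym (ℕₚ.n∸n≡0 n))))) ⟩
    sumTo R n (λ l → sumTo R l (λ k → f k (l ∸ k))) + sumTo R (suc n) (λ k → f k (suc n ∸ k)) ∎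
    where
    peel : ∀ k → k ℕ.≤ n → sumTo R (suc n ∸ k) (f k) ≈ sumTo R (n ∸ k) (f k) + f k (suc n ∸ k)
    peel k k≤n rewrite ℕₚ.+-∸-assoc 1 k≤n = refl

  prod1-cong : ∀ n {f g : ℕ → Carrier} → (∀ i → f (suc i) ≈ g (suc i)) → prod1 R n f ≈ prod1 R n g
  prod1-cong zero    f≈g = refl
  prod1-cong (suc n) f≈g = *-cong (prod1-cong n f≈g) (f≈g n)

  prod1-head : ∀ n (f : ℕ → Carrier) → prod1 R (suc n) f ≈ f 1 * prod1 R n (λ i → f (suc i))
  prod1-head zero    f = trans (*-identityˡ _) (sym (*-identityʳ _))
  prod1-head (suc n) f = trans (*-congʳ (prod1-head n f)) (*-assoc _ _ _)

module QPascal {c ℓ : Level} (R : CommutativeRing c ℓ) (q : CommutativeRing.Carrier R) where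
  open CommutativeRing R
  open RingFacts R
  open import Relation.Binary.Reasoning.Setoid setoid
  open import Algebra.Solver.Ring.NaturalCoefficients.Default commutativeSemiring
    using (solve; _:=_; _:+_; _:*_)
  open import Algebra.Properties.Ring ring using (-‿distribˡ-*; -1*x≈-x)

  qPascal : ℕ → ℕ → Carrier
  qPascal m       zero    = 1#
  qPascal zero    (suc k) = 0#
  qPascal (suc m) (suc k) = qPascal m k + pow R q (suc k) * qPascal m (suc k)

  qPascal-vanishes : ∀ m k → m ℕ.< k → qPascal m k ≈ 0#
  qPascal-vanishes zero    (suc k) _         = refl
  qPascal-vanishes (suc m) (suc k) (s≤s m<k) = begin
    qPascal m k + pow R q (suc k) * qPascal m (suc k)
      ≈⟨ +-cong (qPascal-vanishes m k m<k) (*-congˡ (qPascal-vanishes m (suc k) (ℕₚ.m<n⇒m<1+n m<k))) ⟩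
    0# + pow R q (suc k) * 0#
      ≈⟨ trans (+-identityˡ _) (zeroʳ _) ⟩
    0# ∎

  qPascal-diag : ∀ m → qPascal m m ≈ 1#
  qPascal-diag zero    = refl
  qPascal-diag (suc m) = begin
    qPascal m m + pow R q (suc m) * qPascal m (suc m)
      ≈⟨ +-cong (qPascal-diag m) (*-congˡ (qPascal-vanishes m (suc m) ℕₚ.≤-refl)) ⟩
    1# + pow R q (suc m) * 0#
      ≈⟨ trans (+-congˡ (zeroʳ _)) (+-identityʳ _) ⟩
    1# ∎

  qint-homo-+ : ∀ a b → qint R q (a ℕ.+ b) ≈ qint R q a + pow R q a * qint R q b
  qint-homo-+ zero    b = sym (trans (+-identityˡ _) (*-identityˡ _))
  qint-homo-+ (suc a) b = begin
    1# + q * qint R q (a ℕ.+ b)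
      ≈⟨ +-congˡ (*-congˡ (qint-homo-+ a b)) ⟩
    1# + q * (qint R q a + pow R q a * qint R q b)
      ≈⟨ solve 5 (λ o q x p y → o :+ q :* (x :+ p :* y) := (o :+ q :* x) :+ (q :* p) :* y)
               refl 1# q _ _ _ ⟩
    (1# + q * qint R q a) + (q * pow R q a) * qint R q b ∎

  qPascalPoly : ℕ → Carrier → Carrier
  qPascalPoly m z = sumTo R m (λ i → qPascal m i * (pow R q (i C 2) * pow R z i))

  qPascalPoly-suc : ∀ m z → (1# + z) * qPascalPoly m (z * q) ≈ qPascalPoly (suc m) z
  qPascalPoly-suc m z = begin
    (1# + z) * S
      ≈⟨ trans (distribʳ S 1# z) (+-congʳ (*-identityˡ S)) ⟩
    S + z * S
      ≈⟨ +-cong (sym (sumTo-shift m a a[1+m]≈0)) (sumTo-distribˡ m z a) ⟩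
    (a 0 + sumTo R m (λ j → a (suc j))) + sumTo R m (λ j → z * a j)
      ≈⟨ solve 3 (λ u v w → (u :+ v) :+ w := u :+ (w :+ v)) refl _ _ _ ⟩
    a 0 + (sumTo R m (λ j → z * a j) + sumTo R m (λ j → a (suc j)))
      ≈⟨ +-congˡ (sym (sumTo-distrib-+ m _ _)) ⟩
    a 0 + sumTo R m (λ j → z * a j + a (suc j))
      -- a 0 and b 0 both compute to 1# * (1# * 1#)
      ≈⟨ +-congˡ (sumTo-cong m (λ j _ → b[1+j]≈ j)) ⟨
    b 0 + sumTo R m (λ j → b (suc j))
      ≈⟨ sumTo-head m b ⟨
    qPascalPoly (suc m) z ∎
    where
    a b : ℕ → Carrier
    a i = qPascal m i * (pow R q (i C 2) * pow R (z * q) i)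
    b i = qPascal (suc m) i * (pow R q (i C 2) * pow R z i)
    S = qPascalPoly m (z * q)

    a[1+m]≈0 : a (suc m) ≈ 0#
    a[1+m]≈0 = trans (*-congʳ (qPascal-vanishes m (suc m) ℕₚ.≤-refl)) (zeroˡ _)

    b[1+j]≈ : ∀ j → b (suc j) ≈ z * a j + a (suc j)
    b[1+j]≈ j = begin
      (g + (q * qʲ) * g′) * (pow R q (suc j C 2) * (z * zʲ))
        ≈⟨ *-congˡ (*-congʳ q[1+j]C2≈) ⟩
      (g + (q * qʲ) * g′) * ((qʲ * Q) * (z * zʲ))
        ≈⟨ solve 7 (λ z g g′ Q zʲ qʲ q → (g :+ (q :* qʲ) :* g′) :* ((qʲ :* Q) :* (z :* zʲ))
                    := z :* (g :* (Q :* (zʲ :* qʲ))) :+ g′ :* ((qʲ :* Q) :* ((z :* q) :* (zʲ :* qʲ))))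
                 refl z g g′ Q zʲ qʲ q ⟩
      z * (g * (Q * (zʲ * qʲ))) + g′ * ((qʲ * Q) * ((z * q) * (zʲ * qʲ)))
        ≈⟨ +-cong (*-congˡ (*-congˡ (*-congˡ (pow-distrib-* z q j))))
                  (*-congˡ (*-cong q[1+j]C2≈ (*-congˡ (pow-distrib-* z q j)))) ⟨
      z * a j + a (suc j) ∎
      where
      g = qPascal m j
      g′ = qPascal m (suc j)
      Q = pow R q (j C 2)
      qʲ = pow R q j
      zʲ = pow R z j
      q[1+j]C2≈ : pow R q (suc j C 2) ≈ qʲ * Q
      q[1+j]C2≈ = trans (reflexive (≡.cong (pow R q) (suc[n]C2≡n+nC2 j))) (pow-homo-+ q j (j C 2))

  q-binomial-theorem : ∀ m z → prod1 R m (λ i → 1# + z * pow R q (i ∸ 1)) ≈ qPascalPoly m z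
  q-binomial-theorem zero    z = sym (trans (*-identityˡ _) (*-identityˡ _))
  q-binomial-theorem (suc m) z = begin
    prod1 R (suc m) (λ i → 1# + z * pow R q (i ∸ 1))
      ≈⟨ prod1-head m _ ⟩
    (1# + z * 1#) * prod1 R m (λ i → 1# + z * pow R q i)
      ≈⟨ *-cong (+-congˡ (*-identityʳ z)) (prod1-cong m (λ i → +-congˡ (sym (*-assoc z q _)))) ⟩
    (1# + z) * prod1 R m (λ i → 1# + (z * q) * pow R q (i ∸ 1))
      ≈⟨ *-congˡ (q-binomial-theorem m (z * q)) ⟩
    (1# + z) * qPascalPoly m (z * q)
      ≈⟨ qPascalPoly-suc m z ⟩
    qPascalPoly (suc m) z ∎

  qpochMinus-expansion : ∀ m x → qpochMinus R q x m
    ≈ sumTo R m (λ i → qPascal m i * (pow R (- 1#) i * (pow R q (i C 2) * pow R x i)))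
  qpochMinus-expansion m x = begin
    qpochMinus R q x m
      ≈⟨ prod1-cong m (λ i → +-congˡ (-‿distribˡ-* x _)) ⟩
    prod1 R m (λ i → 1# + (- x) * pow R q (i ∸ 1))
      ≈⟨ q-binomial-theorem m (- x) ⟩
    qPascalPoly m (- x)
      ≈⟨ sumTo-cong m (λ i _ → *-congˡ (*-congˡ (-x^i≈ i))) ⟩
    sumTo R m (λ i → qPascal m i * (pow R q (i C 2) * (pow R (- 1#) i * pow R x i)))
      ≈⟨ sumTo-cong m (λ i _ → *-congˡ (solve 3 (λ a b c → a :* (b :* c) := b :* (a :* c)) refl _ _ _)) ⟩
    sumTo R m (λ i → qPascal m i * (pow R (- 1#) i * (pow R q (i C 2) * pow R x i))) ∎
    where
    -x^i≈ : ∀ i → pow R (- x) i ≈ pow R (- 1#) i * pow R x i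
    -x^i≈ i = trans (pow-congˡ i (sym (-1*x≈-x x))) (pow-distrib-* (- 1#) x i)

module QBinomialCoefficients {c ℓ : Level} (R : CommutativeRing c ℓ)
  (q : CommutativeRing.Carrier R) (inv : ℕ → CommutativeRing.Carrier R) (N : ℕ)
  (inv-qint : ∀ j → 1 ℕ.≤ j → j ℕ.≤ N →
              CommutativeRing._≈_ R (CommutativeRing._*_ R (inv j) (qint R q j)) (CommutativeRing.1# R))
  where
  open CommutativeRing R
  open QPascal R q
  open import Relation.Binary.Reasoning.Setoid setoid
  open import Algebra.Solver.Ring.NaturalCoefficients.Default commutativeSemiring
    using (solve; _:=_; _:+_; _:*_)

  private
    [_]  = qint R q
    _!   = qfact R q
    _!⁻¹ = qfactInv R inv

  qfact-qfactInv : ∀ m → m ℕ.≤ N → m ! * m !⁻¹ ≈ 1#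
  qfact-qfactInv zero    _    = *-identityˡ _
  qfact-qfactInv (suc m) m<N = begin
    (m ! * [ suc m ]) * (m !⁻¹ * inv (suc m))
      ≈⟨ solve 4 (λ a b c d → (a :* b) :* (c :* d) := (a :* c) :* (d :* b)) refl _ _ _ _ ⟩
    (m ! * m !⁻¹) * (inv (suc m) * [ suc m ])
      ≈⟨ *-cong (qfact-qfactInv m (ℕₚ.<⇒≤ m<N)) (inv-qint (suc m) (s≤s z≤n) m<N) ⟩
    1# * 1#
      ≈⟨ *-identityˡ _ ⟩
    1# ∎

  qfactInv-pred : ∀ k → suc k ℕ.≤ N → k !⁻¹ ≈ suc k !⁻¹ * [ suc k ]
  qfactInv-pred k k<N = begin
    k !⁻¹                          ≈⟨ *-identityʳ _ ⟨
    k !⁻¹ * 1#                     ≈⟨ *-congˡ (inv-qint (suc k) (s≤s z≤n) k<N) ⟨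
    k !⁻¹ * (inv (suc k) * [ suc k ]) ≈⟨ *-assoc _ _ _ ⟨
    suc k !⁻¹ * [ suc k ]          ∎

  qbinom₂ : ℕ → ℕ → Carrier
  qbinom₂ a b = (a ℕ.+ b) ! * (a !⁻¹ * b !⁻¹)

  qbinom₂≈qPascal : ∀ a b → a ℕ.+ b ℕ.≤ N → qbinom₂ a b ≈ qPascal (a ℕ.+ b) a
  qbinom₂≈qPascal zero    b       a+b≤N = trans (*-congˡ (*-identityˡ _)) (qfact-qfactInv b a+b≤N)
  qbinom₂≈qPascal (suc a) zero    a+b≤N = begin
    (suc a ℕ.+ 0) ! * (suc a !⁻¹ * 1#)
      ≈⟨ *-cong (reflexive (≡.cong _! a+0≡a)) (*-identityʳ _) ⟩
    suc a ! * suc a !⁻¹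
      ≈⟨ qfact-qfactInv (suc a) (≡.subst (ℕ._≤ N) a+0≡a a+b≤N) ⟩
    1#
      ≈⟨ qPascal-diag (suc a) ⟨
    qPascal (suc a) (suc a)
      ≡⟨ ≡.cong (λ t → qPascal t (suc a)) a+0≡a ⟨
    qPascal (suc a ℕ.+ 0) (suc a) ∎
    where a+0≡a = ℕₚ.+-identityʳ (suc a)
  qbinom₂≈qPascal (suc a) (suc b) a+b≤N = begin
    (M ! * [ suc M ]) * (suc a !⁻¹ * suc b !⁻¹)
      ≈⟨ *-congʳ (*-congˡ (qint-homo-+ (suc a) (suc b))) ⟩
    (M ! * ([ suc a ] + pow R q (suc a) * [ suc b ])) * (suc a !⁻¹ * suc b !⁻¹)
      ≈⟨ solve 6 (λ f x p y X Y → (f :* (x :+ p :* y)) :* (X :* Y)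
                    := f :* ((X :* x) :* Y) :+ p :* (f :* (X :* (Y :* y))))
               refl (M !) [ suc a ] (pow R q (suc a)) [ suc b ] (suc a !⁻¹) (suc b !⁻¹) ⟩
    M ! * ((suc a !⁻¹ * [ suc a ]) * suc b !⁻¹) + pow R q (suc a) * (M ! * (suc a !⁻¹ * (suc b !⁻¹ * [ suc b ])))
      ≈⟨ +-cong (*-congˡ (*-congʳ (qfactInv-pred a a<N)))
                (*-congˡ (*-congˡ (*-congˡ (qfactInv-pred b b<N)))) ⟨
    qbinom₂ a (suc b) + pow R q (suc a) * (M ! * (suc a !⁻¹ * b !⁻¹))
      ≈⟨ +-congˡ (*-congˡ (*-congʳ (reflexive (≡.cong _! M≡)))) ⟩
    qbinom₂ a (suc b) + pow R q (suc a) * qbinom₂ (suc a) b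
      ≈⟨ +-cong (qbinom₂≈qPascal a (suc b) (ℕₚ.<⇒≤ a+b≤N))
                (*-congˡ (trans (qbinom₂≈qPascal (suc a) b (≡.subst (ℕ._≤ N) M≡ (ℕₚ.<⇒≤ a+b≤N)))
                                (reflexive (≡.cong (λ t → qPascal t (suc a)) (≡.sym M≡))))) ⟩
    qPascal M a + pow R q (suc a) * qPascal M (suc a) ∎
    where
    M = a ℕ.+ suc b
    M≡ : M ≡ suc a ℕ.+ b
    M≡ = ℕₚ.+-suc a b
    a<N : suc a ℕ.≤ N
    a<N = ℕₚ.≤-trans (s≤s (ℕₚ.m≤m+n a (suc b))) a+b≤N
    b<N : suc b ℕ.≤ N
    b<N = ℕₚ.≤-trans (ℕₚ.m≤n⇒m≤1+n (ℕₚ.m≤n+m (suc b) a)) a+b≤N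

  qbinom≈qPascal : ∀ M i → i ℕ.≤ M → M ℕ.≤ N → qbinom R q inv M i ≈ qPascal M i
  qbinom≈qPascal M i i≤M M≤N = begin
    M ! * (i !⁻¹ * (M ∸ i) !⁻¹)  ≡⟨ ≡.cong (λ t → t ! * (i !⁻¹ * (M ∸ i) !⁻¹)) i+[M∸i]≡M ⟨
    qbinom₂ i (M ∸ i)            ≈⟨ qbinom₂≈qPascal i (M ∸ i) (≡.subst (ℕ._≤ N) (≡.sym i+[M∸i]≡M) M≤N) ⟩
    qPascal (i ℕ.+ (M ∸ i)) i    ≡⟨ ≡.cong (λ t → qPascal t i) i+[M∸i]≡M ⟩
    qPascal M i                  ∎
    where i+[M∸i]≡M = ℕₚ.m+[n∸m]≡n i≤M

  qbinom-*-qbinom : ∀ n k i → n ℕ.≤ N → k ℕ.+ i ℕ.≤ n →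
    qbinom R q inv n k * qbinom R q inv (n ∸ k) i
      ≈ qbinom R q inv n (k ℕ.+ i) * qbinom R q inv (k ℕ.+ i) k
  qbinom-*-qbinom n k i n≤N k+i≤n = begin
    (n ! * (k !⁻¹ * (n ∸ k) !⁻¹)) * ((n ∸ k) ! * (i !⁻¹ * (n ∸ k ∸ i) !⁻¹))
      ≈⟨ solve 6 (λ f a b c d e → (f :* (a :* b)) :* (c :* (d :* e)) := (f :* (a :* (d :* e))) :* (c :* b))
               refl (n !) (k !⁻¹) ((n ∸ k) !⁻¹) ((n ∸ k) !) (i !⁻¹) ((n ∸ k ∸ i) !⁻¹) ⟩
    (n ! * (k !⁻¹ * (i !⁻¹ * (n ∸ k ∸ i) !⁻¹))) * ((n ∸ k) ! * (n ∸ k) !⁻¹)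
      ≈⟨ cancel (qfact-qfactInv (n ∸ k) (ℕₚ.≤-trans (ℕₚ.m∸n≤m n k) n≤N)) ⟩
    n ! * (k !⁻¹ * (i !⁻¹ * (n ∸ k ∸ i) !⁻¹))
      ≡⟨ ≡.cong₂ (λ s t → n ! * (k !⁻¹ * (s !⁻¹ * t !⁻¹))) (≡.sym (ℕₚ.m+n∸m≡n k i)) (ℕₚ.∸-+-assoc n k i) ⟩
    n ! * (k !⁻¹ * ((j ∸ k) !⁻¹ * (n ∸ j) !⁻¹))
      ≈⟨ cancel (qfact-qfactInv j (ℕₚ.≤-trans k+i≤n n≤N)) ⟨
    (n ! * (k !⁻¹ * ((j ∸ k) !⁻¹ * (n ∸ j) !⁻¹))) * (j ! * j !⁻¹)
      ≈⟨ solve 6 (λ f a d e y x → (f :* (a :* (d :* e))) :* (y :* x) := (f :* (x :* e)) :* (y :* (a :* d)))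
               refl (n !) (k !⁻¹) ((j ∸ k) !⁻¹) ((n ∸ j) !⁻¹) (j !) (j !⁻¹) ⟩
    (n ! * (j !⁻¹ * (n ∸ j) !⁻¹)) * (j ! * (k !⁻¹ * (j ∸ k) !⁻¹)) ∎
    where
    j = k ℕ.+ i
    cancel : ∀ {a b} → b ≈ 1# → a * b ≈ a
    cancel b≈1 = trans (*-congˡ b≈1) (*-identityʳ _)

module QBernsteinMoments {c ℓ : Level} (R : CommutativeRing c ℓ)
  (q : CommutativeRing.Carrier R) (inv : ℕ → CommutativeRing.Carrier R) (n : ℕ)
  (inv-qint : ∀ j → 1 ℕ.≤ j → j ℕ.≤ n →
              CommutativeRing._≈_ R (CommutativeRing._*_ R (inv j) (qint R q j)) (CommutativeRing.1# R))
  (m : ℕ) (x : CommutativeRing.Carrier R)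
  where
  open CommutativeRing R
  open RingFacts R
  open QPascal R q
  open QBinomialCoefficients R q inv n inv-qint
  open import Relation.Binary.Reasoning.Setoid setoid
  open import Algebra.Solver.Ring.NaturalCoefficients.Default commutativeSemiring
    using (solve; _:=_; _:*_)

  private
    [_] = qint R q
    qb  = qbinom R q inv

  qBernsteinTerm : ℕ → Carrier
  qBernsteinTerm k = qb n k * (pow R x k * qpochMinus R q x (n ∸ k))

  expandedTerm : ℕ → ℕ → Carrier
  expandedTerm k i = qb n (k ℕ.+ i) * (pow R x (k ℕ.+ i)
                   * (qb (k ℕ.+ i) k * (pow R (- 1#) i * (pow R q (i C 2) * pow R [ k ] m))))

  qBernstein-rescale : 1 ℕ.≤ n → ∀ k →
    pow R [ n ] m * (pow R ([ k ] * inv n) m * qBernsteinTerm k) ≈ pow R [ k ] m * qBernsteinTerm k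
  qBernstein-rescale 1≤n k = begin
    pow R [ n ] m * (pow R ([ k ] * inv n) m * T)
      ≈⟨ *-congˡ (*-congʳ (pow-distrib-* [ k ] (inv n) m)) ⟩
    pow R [ n ] m * ((pow R [ k ] m * pow R (inv n) m) * T)
      ≈⟨ solve 4 (λ a b c t → a :* ((b :* c) :* t) := (c :* a) :* (b :* t)) refl _ _ _ _ ⟩
    (pow R (inv n) m * pow R [ n ] m) * (pow R [ k ] m * T)
      ≈⟨ *-congʳ (pow-distrib-* (inv n) [ n ] m) ⟨
    pow R (inv n * [ n ]) m * (pow R [ k ] m * T)
      ≈⟨ *-congʳ (trans (pow-congˡ m (inv-qint n 1≤n ℕₚ.≤-refl)) (pow-1# m)) ⟩
    1# * (pow R [ k ] m * T)
      ≈⟨ *-identityˡ _ ⟩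
    pow R [ k ] m * T ∎
    where T = qBernsteinTerm k

  qBernsteinTerm-expansion : ∀ k → k ℕ.≤ n →
    pow R [ k ] m * qBernsteinTerm k ≈ sumTo R (n ∸ k) (expandedTerm k)
  qBernsteinTerm-expansion k k≤n = begin
    pow R [ k ] m * (qb n k * (pow R x k * qpochMinus R q x (n ∸ k)))
      ≈⟨ *-congˡ (*-congˡ (*-congˡ (qpochMinus-expansion (n ∸ k) x))) ⟩
    pow R [ k ] m * (qb n k * (pow R x k * sumTo R (n ∸ k) (λ i → qPascal (n ∸ k) i * t i)))
      ≈⟨ *-congˡ (*-congˡ (sumTo-distribˡ (n ∸ k) _ _)) ⟩
    pow R [ k ] m * (qb n k * sumTo R (n ∸ k) (λ i → pow R x k * (qPascal (n ∸ k) i * t i)))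
      ≈⟨ *-congˡ (sumTo-distribˡ (n ∸ k) _ _) ⟩
    pow R [ k ] m * sumTo R (n ∸ k) (λ i → qb n k * (pow R x k * (qPascal (n ∸ k) i * t i)))
      ≈⟨ sumTo-distribˡ (n ∸ k) _ _ ⟩
    sumTo R (n ∸ k) (λ i → pow R [ k ] m * (qb n k * (pow R x k * (qPascal (n ∸ k) i * t i))))
      ≈⟨ sumTo-cong (n ∸ k) regroup ⟩
    sumTo R (n ∸ k) (expandedTerm k) ∎
    where
    t : ℕ → Carrier
    t i = pow R (- 1#) i * (pow R q (i C 2) * pow R x i)

    regroup : ∀ i → i ℕ.≤ n ∸ k →
      pow R [ k ] m * (qb n k * (pow R x k * (qPascal (n ∸ k) i * t i))) ≈ expandedTerm k i
    regroup i i≤n∸k = begin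
      pow R [ k ] m * (qb n k * (pow R x k * (qPascal (n ∸ k) i * t i)))
        ≈⟨ *-congˡ (*-congˡ (*-congˡ (*-congʳ (qbinom≈qPascal (n ∸ k) i i≤n∸k (ℕₚ.m∸n≤m n k))))) ⟨
      pow R [ k ] m * (qb n k * (pow R x k * (qb (n ∸ k) i * (s * (Q * pow R x i)))))
        ≈⟨ solve 7 (λ p a b c s t d → p :* (a :* (b :* (c :* (s :* (t :* d)))))
                      := (a :* c) :* ((b :* d) :* (s :* (t :* p))))
                 refl (pow R [ k ] m) (qb n k) (pow R x k) (qb (n ∸ k) i) s Q (pow R x i) ⟩
      (qb n k * qb (n ∸ k) i) * ((pow R x k * pow R x i) * (s * (Q * pow R [ k ] m)))
        ≈⟨ *-cong (qbinom-*-qbinom n k i ℕₚ.≤-refl k+i≤n) (*-congʳ (sym (pow-homo-+ x k i))) ⟩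
      (qb n (k ℕ.+ i) * qb (k ℕ.+ i) k) * (pow R x (k ℕ.+ i) * (s * (Q * pow R [ k ] m)))
        ≈⟨ solve 4 (λ a b y w → (a :* b) :* (y :* w) := a :* (y :* (b :* w))) refl _ _ _ _ ⟩
      expandedTerm k i ∎
      where
      s = pow R (- 1#) i
      Q = pow R q (i C 2)
      k+i≤n : k ℕ.+ i ℕ.≤ n
      k+i≤n = ≡.subst (k ℕ.+ i ℕ.≤_) (ℕₚ.m+[n∸m]≡n k≤n) (ℕₚ.+-monoʳ-≤ k i≤n∸k)

  expandedTerm-antidiagonal : ∀ l →
    sumTo R l (λ k → expandedTerm k (l ∸ k)) ≈ qb n l * (pow R x l * qDelta0 R q inv l m)
  expandedTerm-antidiagonal l = begin
    sumTo R l (λ k → expandedTerm k (l ∸ k))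
      ≈⟨ sumTo-cong l (λ k k≤l → reflexive (≡.cong (λ s → qb n s * (pow R x s * (qb s k * u k)))
                                                     (ℕₚ.m+[n∸m]≡n k≤l))) ⟩
    sumTo R l (λ k → qb n l * (pow R x l * (qb l k * u k)))
      ≈⟨ trans (*-congˡ (sumTo-distribˡ l _ _)) (sumTo-distribˡ l _ _) ⟨
    qb n l * (pow R x l * qDelta0 R q inv l m) ∎
    where
    u : ℕ → Carrier
    u k = pow R (- 1#) (l ∸ k) * (pow R q ((l ∸ k) C 2) * pow R [ k ] m)

  qBernstein-moment : 1 ℕ.≤ n →
    pow R [ n ] m * qBernsteinPow R q inv n m x ≈ sumTo R n (λ k → qb n k * (pow R x k * qDelta0 R q inv k m))
  qBernstein-moment 1≤n = begin
    pow R [ n ] m * qBernsteinPow R q inv n m x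
      ≈⟨ sumTo-distribˡ n _ _ ⟩
    sumTo R n (λ k → pow R [ n ] m * (pow R ([ k ] * inv n) m * qBernsteinTerm k))
      ≈⟨ sumTo-cong n (λ k k≤n → trans (qBernstein-rescale 1≤n k) (qBernsteinTerm-expansion k k≤n)) ⟩
    sumTo R n (λ k → sumTo R (n ∸ k) (expandedTerm k))
      ≈⟨ sumTo-antidiagonal n expandedTerm ⟩
    sumTo R n (λ l → sumTo R l (λ k → expandedTerm k (l ∸ k)))
      ≈⟨ sumTo-cong n (λ l _ → expandedTerm-antidiagonal l) ⟩
    sumTo R n (λ k → qb n k * (pow R x k * qDelta0 R q inv k m)) ∎

corollary3 : {c ℓ : Level} (R : CommutativeRing c ℓ) →
    let open CommutativeRing R in
    (q : Carrier) (inv : ℕ → Carrier) (n m : ℕ) → 1 ℕ.≤ n →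
    (∀ j → 1 ℕ.≤ j → j ℕ.≤ n → inv j * qint R q j ≈ 1#) →
    (x : Carrier) →
    pow R (qint R q n) m * qBernsteinPow R q inv n m x
      ≈ sumTo R n (λ k → qbinom R q inv n k * (pow R x k * qDelta0 R q inv k m))
corollary3 R q inv n m 1≤n inv-qint x = QBernsteinMoments.qBernstein-moment R q inv n inv-qint m x 1≤n
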